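{- Let $\mathcal M=\langle W,R,\{\mathcal M_w\}_{w\in W}\rangle$ be a concrete mixed model and, for each $w\in W$, let $T_w:=\{\varphi\in\mathsf{Form}_\Box\mid \overline w\Vdash\varphi\}$. Then the triple $\langle W,R,\{T_w\}_{w\in W}\rangle$ is a mixed model in $\mathcal{MM}(\mathsf{CPC},\mathsf{IPC})$.
   Context: The modal language $\mathsf{Form}_\Box$ is generated by $\top$, $\bot$, propositional variables $p\in\mathsf{Prop}$, and $(\varphi\wedge\psi)$, $(\varphi\vee\psi)$, $(\varphi\to\psi)$, $\Box\varphi$; $\neg\varphi$ abbreviates $\varphi\to\bot$. $\mathsf{IPC}$ (over the modal language) is the Hilbert system whose axioms are all instances, with $A,B,C$ arbitrary formulas of $\mathsf{Form}_\Box$, of the schemes $A\to(B\to A)$; $(A\to B)\to((A\to(B\to C))\to(A\to C))$; $A\to(A\vee B)$; $B\to(A\vee B)$; $(A\vee B)\to((A\to C)\to((B\to C)\to C))$; $A\to(B\to(A\wedge B))$; $(A\wedge B)\to A$; $(A\wedge B)\to B$; $\bot\to A$; its only rule is modus ponens. $\mathsf{CPC}$ adds the scheme $\neg A\vee A$. For a logic $L$ and $\Gamma\subseteq\mathsf{Form}_\Box$, $\Gamma\vdash_L\varphi$ means there is a finite sequence ending in $\varphi$ each member of which is an axiom of $L$, a member of $\Gamma$, or obtained by modus ponens from earlier members. An intuitionistic Kripke model is $\langle U,\leq,V\rangle$ with $U\ne\emptyset$, $\leq$ a partial order, $V:U\to\mathcal P(\mathsf{Prop})$ monotone in $\leq$;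 rooted if it has a least element. A concrete mixed model is $\langle W,R,\{\mathcal M_w\}_{w\in W}\rangle$ with $W\ne\emptyset$, $R\subseteq W\times W$, each $\mathcal M_w=\langle W_w,\leq_w,V_w\rangle$ a rooted intuitionistic Kripke model with root $\overline w$, the $W_w$ pairwise disjoint; $\leq$, $V$ denote the unions of the $\leq_w$, $V_w$. Forcing at a point $x\in\bigcup_w W_w$: $x\Vdash p$ iff $p\in V(x)$; $x\nVdash\bot$; $\wedge,\vee$ pointwise; $x\Vdash\varphi\to\psi$ iff for all $y\geq x$, $y\Vdash\varphi$ implies $y\Vdash\psi$; $x\Vdash\Box\varphi$ iff $\overline v\Vdash\varphi$ for all $v\in W$ with $wRv$, where $w$ is the unique element of $W$ with $\overline w\leq x$. The class $\mathcal{MM}(\mathsf{CPC},\mathsf{IPC})$ consists of triples $\langle W,R,\{T_w\}_{w\in W}\rangle$ with $W$ a nonempty set, $R\subseteq W\times W$, each $T_w\subseteq\mathsf{Form}_\Box$, such that for each $w\in W$ there is a logic $L_w\in\{\mathsf{CPC},\mathsf{IPC}\}$ with: (1) $\bot\notin T_w$; (2) $T_w\vdash_{L_w}\varphi$ implies $\varphi\in T_w$; (3) $\Box\varphi\in T_w$ iff for all $v\in W$ with $wRv$, $\varphi\in T_v$; (4) $\neg\Box\varphi\in T_w$ iff there is $v\in W$ with $wRv$ and $\varphi\notin T_v$ (for all $\varphi\in\mathsf{Form}_\Box$). -}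

module Defs where

open import Data.Product using (Σ; _×_; _,_; proj₁; proj₂; ∃-syntax)
open import Data.Sum using (_⊎_)
open import Data.Unit using () renaming (⊤ to 𝟙)
open import Data.Empty using () renaming (⊥ to 𝟘)
open import Relation.Nullary using (¬_)
open import Relation.Binary.PropositionalEquality using (_≡_)
open import Relation.Binary.Structures using (IsPartialOrder)

infixr 6 _∧_
infixr 5 _∨_
infixr 4 _⇒_

data Form (P : Set) : Set where
  ⊤ ⊥  : Form P
  var  : P → Form P
  _∧_  : Form P → Form P → Form P
  _∨_  : Form P → Form P → Form P
  _⇒_  : Form P → Form P → Form P
  □    : Form P → Form P

¬f : {P : Set} → Form P → Form P
¬f φ = φ ⇒ ⊥

data Logic : Set where
  CPC IPC : Logic

data IPCAxiom {P : Set} : Form P → Set where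
  ax1 : ∀ A B → IPCAxiom (A ⇒ (B ⇒ A))
  ax2 : ∀ A B C → IPCAxiom ((A ⇒ B) ⇒ ((A ⇒ (B ⇒ C)) ⇒ (A ⇒ C)))
  ax3 : ∀ A B → IPCAxiom (A ⇒ (A ∨ B))
  ax4 : ∀ A B → IPCAxiom (B ⇒ (A ∨ B))
  ax5 : ∀ A B C → IPCAxiom ((A ∨ B) ⇒ ((A ⇒ C) ⇒ ((B ⇒ C) ⇒ C)))
  ax6 : ∀ A B → IPCAxiom (A ⇒ (B ⇒ (A ∧ B)))
  ax7 : ∀ A B → IPCAxiom ((A ∧ B) ⇒ A)
  ax8 : ∀ A B → IPCAxiom ((A ∧ B) ⇒ B)
  ax9 : ∀ A → IPCAxiom (⊥ ⇒ A)

data Axiom {P : Set} : Logic → Form P → Set where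
  ipc : ∀ {L φ} → IPCAxiom φ → Axiom L φ
  lem : ∀ A → Axiom CPC (¬f A ∨ A)

data _⊢[_]_ {P : Set} (Γ : Form P → Set) (L : Logic) : Form P → Set where
  axiom : ∀ {φ} → Axiom L φ → Γ ⊢[ L ] φ
  hyp   : ∀ {φ} → Γ φ → Γ ⊢[ L ] φ
  mp    : ∀ {φ ψ} → Γ ⊢[ L ] (φ ⇒ ψ) → Γ ⊢[ L ] φ → Γ ⊢[ L ] ψ

record RootedKripke (P : Set) : Set₁ where
  field
    U       : Set
    _≤_     : U → U → Set
    isPO    : IsPartialOrder _≡_ _≤_
    V       : U → P → Set
    V-mono  : ∀ {x y} → x ≤ y → ∀ p → V x p → V y p
    root    : U
    root-≤  : ∀ x → root ≤ x

-- Concrete mixed model; the disjoint union of the W_w is Σ W (U ∘ M)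
record ConcreteMixedModel (P : Set) : Set₁ where
  field
    W    : Set
    w₀   : W              -- W nonempty
    R    : W → W → Set
    M    : W → RootedKripke P

  open RootedKripke

  Point : Set
  Point = Σ W (λ w → U (M w))

  rootOf : W → Point
  rootOf w = w , root (M w)

  _⊩_ : Point → Form P → Set
  (w , x) ⊩ ⊤ = 𝟙
  (w , x) ⊩ ⊥ = 𝟘
  (w , x) ⊩ var p = V (M w) x p
  (w , x) ⊩ (φ ∧ ψ) = ((w , x) ⊩ φ) × ((w , x) ⊩ ψ)
  (w , x) ⊩ (φ ∨ ψ) = ((w , x) ⊩ φ) ⊎ ((w , x) ⊩ ψ)
  (w , x) ⊩ (φ ⇒ ψ) = ∀ y → _≤_ (M w) x y → (w , y) ⊩ φ → (w , y) ⊩ ψ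
  (w , x) ⊩ □ φ = ∀ v → R w v → rootOf v ⊩ φ

  T : W → Form P → Set
  T w φ = rootOf w ⊩ φ

record IsMixedModel {P : Set} (W : Set) (R : W → W → Set) (T : W → Form P → Set) : Set₁ where
  field
    nonempty : W
    conditions : ∀ w → Σ Logic λ L →
        (¬ T w ⊥)
      × (∀ φ → T w ⊢[ L ] φ → T w φ)
      × (∀ φ → (T w (□ φ) → ∀ v → R w v → T v φ) × ((∀ v → R w v → T v φ) → T w (□ φ)))
      × (∀ φ → (T w (¬f (□ φ)) → ∃[ v ] (R w v × ¬ T v φ))
               × (∃[ v ] (R w v × ¬ T v φ) → T w (¬f (□ φ))))

{-# OPTIONS --safe #-}
-- Forcing is persistent, so every point forces all IPC axioms and its forced
-- formulas are closed under modus ponens: each T_w is an IPC theory. Since □φ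
-- is evaluated at the world rather than at the point, condition (3) is the
-- forcing clause of □ itself, and a point forces ¬□φ exactly when □φ fails
-- at its world; excluded middle turns that failure into a successor v with
-- φ ∉ T_v.
module Submission where

open import Defs
open import Axiom.ExcludedMiddle using (ExcludedMiddle)
open import Axiom.DoubleNegationElimination using (DoubleNegationElimination; em⇒dne)
open import Level using (zero)
open import Data.Product using (_×_; _,_; proj₁; proj₂; ∃-syntax)
open import Data.Sum using (inj₁; inj₂; [_,_]′)
open import Function using (_∘_)
open import Relation.Nullary using (¬_)
open import Relation.Binary.Structures using (IsPartialOrder)

¬∀⟶∃¬ : DoubleNegationElimination zero → {A : Set} {B Q : A → Set} →
        ¬ (∀ a → B a → Q a) → ∃[ a ] (B a × ¬ Q a)
¬∀⟶∃¬ dne ¬∀ = dne λ ¬∃ → ¬∀ λ a b → dne λ ¬q → ¬∃ (a , b , ¬q)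

module _ {P : Set} (𝓜 : ConcreteMixedModel P) where
  open ConcreteMixedModel 𝓜
  open RootedKripke

  private
    variable
      w : W
      φ : Form P

  ≤-refl : {x : U (M w)} → _≤_ (M w) x x
  ≤-refl {w} = IsPartialOrder.refl (isPO (M w))

  ≤-trans : {x y z : U (M w)} → _≤_ (M w) x y → _≤_ (M w) y z → _≤_ (M w) x z
  ≤-trans {w} = IsPartialOrder.trans (isPO (M w))

  ⊩-mono : ∀ φ {x y : U (M w)} → _≤_ (M w) x y → (w , x) ⊩ φ → (w , y) ⊩ φ
  ⊩-mono ⊤           _   _        = _
  ⊩-mono ⊥           _   ()
  ⊩-mono {w} (var p) x≤y h        = V-mono (M w) x≤y p h
  ⊩-mono (φ ∧ ψ)     x≤y (a , b)  = ⊩-mono φ x≤y a , ⊩-mono ψ x≤y b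
  ⊩-mono (φ ∨ ψ)     x≤y (inj₁ a) = inj₁ (⊩-mono φ x≤y a)
  ⊩-mono (φ ∨ ψ)     x≤y (inj₂ b) = inj₂ (⊩-mono ψ x≤y b)
  ⊩-mono (φ ⇒ ψ)     x≤y h z y≤z  = h z (≤-trans x≤y y≤z)
  ⊩-mono (□ φ)       _   h        = h

  ⊩-IPCAxiom : (x : U (M w)) → IPCAxiom φ → (w , x) ⊩ φ
  ⊩-IPCAxiom _ (ax1 A B)   _ _ a _ y≤z _ = ⊩-mono A y≤z a
  ⊩-IPCAxiom _ (ax2 A B C) _ _ f u y≤z g v z≤v a =
    g v z≤v a v ≤-refl (f v (≤-trans y≤z z≤v) a)
  ⊩-IPCAxiom _ (ax3 A B)   _ _ = inj₁
  ⊩-IPCAxiom _ (ax4 A B)   _ _ = inj₂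
  ⊩-IPCAxiom _ (ax5 A B C) _ _ d _ y≤z f _ z≤u g =
    [ f _ z≤u ∘ ⊩-mono A y≤u , g _ ≤-refl ∘ ⊩-mono B y≤u ]′ d
    where y≤u = ≤-trans y≤z z≤u
  ⊩-IPCAxiom _ (ax6 A B)   _ _ a _ y≤z b = ⊩-mono A y≤z a , b
  ⊩-IPCAxiom _ (ax7 A B)   _ _ = proj₁
  ⊩-IPCAxiom _ (ax8 A B)   _ _ = proj₂
  ⊩-IPCAxiom _ (ax9 A)     _ _ ()

  ⊩-closed-⊢IPC : (x : U (M w)) → ((w , x) ⊩_) ⊢[ IPC ] φ → (w , x) ⊩ φ
  ⊩-closed-⊢IPC x (axiom (ipc a)) = ⊩-IPCAxiom x a
  ⊩-closed-⊢IPC x (hyp h)         = h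
  ⊩-closed-⊢IPC x (mp d e)        = ⊩-closed-⊢IPC x d x ≤-refl (⊩-closed-⊢IPC x e)

  ⊩¬□⇒∃¬T : DoubleNegationElimination zero → ∀ φ {x : U (M w)} →
            (w , x) ⊩ ¬f (□ φ) → ∃[ v ] (R w v × ¬ T v φ)
  ⊩¬□⇒∃¬T dne φ ¬□φ = ¬∀⟶∃¬ dne (¬□φ _ ≤-refl)

  ∃¬T⇒⊩¬□ : ∀ φ {x : U (M w)} → ∃[ v ] (R w v × ¬ T v φ) → (w , x) ⊩ ¬f (□ φ)
  ∃¬T⇒⊩¬□ φ (v , wRv , φ∉Tv) _ _ □φ = φ∉Tv (□φ v wRv)

theorem2p2p4 : ExcludedMiddle Level.zero → {P : Set} (𝓜 : ConcreteMixedModel P) →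
    IsMixedModel (ConcreteMixedModel.W 𝓜) (ConcreteMixedModel.R 𝓜) (ConcreteMixedModel.T 𝓜)
theorem2p2p4 em 𝓜 = record
  { nonempty   = w₀
  ; conditions = λ w → IPC
      , (λ ())
      , (λ φ → ⊩-closed-⊢IPC 𝓜 (root (M w)))
      , (λ φ → (λ □φ → □φ) , (λ □φ → □φ))
      , (λ φ → ⊩¬□⇒∃¬T 𝓜 (em⇒dne em) φ , ∃¬T⇒⊩¬□ 𝓜 φ)
  }
  where
  open ConcreteMixedModel 𝓜
  open RootedKripke
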